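{- Let $G$ be a partially ordered group with identity $e$ and positive cone $G^+ = \{x \in G : x > e\}$. Let $\mathcal{J}$ be a set of nonempty finite subsets of $G^+$, and for $A \subseteq G$ let $\sigma_{\mathcal{J}}(A) = \inf\{ |A\cap J|/|J| : J \in \mathcal{J}\}$. Let $A$ and $B$ be subsets of $G^+$ with $\sigma_{\mathcal{J}}(A) + \sigma_{\mathcal{J}}(B) > 1$. If $x \in G^+$ and the open interval $(e,x) = \{y \in G : e < y < x\}$ belongs to $\mathcal{J}$, then there exist $a \in A$ and $b \in B$ with $ab = x$.
   Context: A partially ordered group is a group $G$ with a partial order $\le$ such that $a \le b$ implies $ac \le bc$ and $ca \le cb$ for all $a,b,c \in G$. We write $x<y$ if $x \le y$ and $x \ne y$. -}

module Defs where

open import Level using (Level; _⊔_; suc)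
open import Data.Nat using (ℕ; _*_; _≤_)
open import Data.Product using (Σ; _×_; _,_; ∃-syntax)
open import Data.List using (List; []; length)
open import Data.List.Membership.Propositional using (_∈_)
open import Data.List.Relation.Unary.All using (All)
open import Data.List.Relation.Unary.Unique.Propositional using (Unique)
open import Data.List.Relation.Binary.Sublist.Propositional using (_⊆_)
open import Relation.Binary.PropositionalEquality using (_≡_; _≢_)
open import Relation.Binary.Structures using (IsPartialOrder)
open import Algebra.Structures using (IsGroup)
open import Function.Bundles using (_⇔_)

record PoGroup (c ℓ : Level) : Set (Level.suc (c ⊔ ℓ)) where
  infixl 7 _∙_
  infix 4 _≤ᴳ_
  field
    Carrier        : Set c
    _∙_            : Carrier → Carrier → Carrier
    e              : Carrier
    _⁻¹            : Carrier → Carrier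
    _≤ᴳ_           : Carrier → Carrier → Set ℓ
    isGroup        : IsGroup _≡_ _∙_ e _⁻¹
    isPartialOrder : IsPartialOrder _≡_ _≤ᴳ_
    mono-right     : ∀ {a b} c → a ≤ᴳ b → a ∙ c ≤ᴳ b ∙ c
    mono-left      : ∀ {a b} c → a ≤ᴳ b → c ∙ a ≤ᴳ c ∙ b

  _<ᴳ_ : Carrier → Carrier → Set (c ⊔ ℓ)
  x <ᴳ y = (x ≤ᴳ y) × (x ≢ y)

  Pos : Carrier → Set (c ⊔ ℓ)
  Pos x = e <ᴳ x

  OpenInterval : Carrier → Carrier → Set (c ⊔ ℓ)
  OpenInterval x y = (e <ᴳ y) × (y <ᴳ x)

-- Finite subsets of G are represented by duplicate-free lists.
module _ {c ℓ : Level} (G : PoGroup c ℓ) where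
  open PoGroup G

  NonemptyFinitePosSubset : List Carrier → Set (c ⊔ ℓ)
  NonemptyFinitePosSubset J = Unique J × (J ≢ []) × All Pos J

  Enumerates : ∀ {p} → List Carrier → (Carrier → Set p) → Set (c ⊔ p)
  Enumerates J P = Unique J × (∀ y → (y ∈ J) ⇔ P y)

  -- |A ∩ J| ≥ k : some k distinct elements of J lie in A
  AtLeastIn : ∀ {a} → (Carrier → Set a) → List Carrier → ℕ → Set (c ⊔ a)
  AtLeastIn A J k = ∃[ S ] (S ⊆ J) × All A S × (length S ≡ k)

  -- σ_𝒥(A) ≥ p / q, i.e. p/q is a lower bound of { |A ∩ J| / |J| : J ∈ 𝒥 }
  DensityLowerBound : ∀ {j a} → (List Carrier → Set j) → (Carrier → Set a) →
                      ℕ → ℕ → Set (c ⊔ j ⊔ a)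
  DensityLowerBound 𝒥 A p q =
    ∀ J → 𝒥 J → ∃[ k ] AtLeastIn A J k × (p * length J ≤ q * k)

-- Inside the interval I = (e, x) the map v ↦ x v⁻¹ is an injection of I into
-- itself, since multiplying e < v < x on the right by v⁻¹, or on the left by
-- x v⁻¹, gives e < x v⁻¹ < x. Take S ⊆ A ∩ I and T ⊆ B ∩ I as large as the
-- densities promise: then |S| + |T| > |I|, so by pigeonhole S meets x T⁻¹,
-- i.e. u = x v⁻¹ for some u ∈ S and v ∈ T.
module Submission where

open import Defs
open import Level using (Level)
open import Data.Nat using (ℕ; _*_; _+_; _<_; NonZero; _≤_)
open import Data.Nat.Properties using (*-cancelʳ-<; *-monoʳ-<; *-monoˡ-≤; +-mono-≤; module ≤-Reasoning)
open import Data.Nat.Tactic.RingSolver using (solve)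
open import Data.Product using (_×_; ∃-syntax; _,_)
open import Data.Sum using (_⊎_; inj₁; inj₂; [_,_]′)
open import Data.Fin using (Fin; zero; suc; splitAt; join)
open import Data.Fin.Properties using (pigeonhole; <⇒≢; join-splitAt)
open import Data.List using (List; []; _∷_; length; lookup; map)
open import Data.List.Properties using (length-map)
open import Data.List.Membership.Propositional using (_∈_)
open import Data.List.Membership.Propositional.Properties using (∈-lookup; ∈-map⁻)
open import Data.List.Relation.Unary.Any using (index)
open import Data.List.Relation.Unary.Any.Properties using (lookup-index)
import Data.List.Relation.Unary.All as All
open import Data.List.Relation.Unary.AllPairs using ([]; _∷_)
open import Data.List.Relation.Unary.Unique.Propositional using (Unique)
open import Data.List.Relation.Unary.Unique.Propositional.Properties using (map⁺)
open import Data.List.Relation.Binary.Sublist.Propositional using (_⊇_; []; _∷_; _∷ʳ_)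
import Data.List.Relation.Binary.Sublist.Propositional as Sublist
open import Data.List.Relation.Binary.Sublist.Propositional.Properties using (All-resp-⊆)
import Data.List.Relation.Binary.Subset.Propositional as Subset
open import Algebra.Bundles using (Group)
open import Algebra.Structures using (IsGroup)
import Algebra.Properties.Group as GroupProperties
open import Function using (_∘_; Injective)
open import Function.Bundles using (Equivalence)
open import Relation.Binary.Definitions using (_Respects_)
open import Relation.Binary.PropositionalEquality using (_≡_; _≢_; refl; sym; trans; cong; subst; subst₂; module ≡-Reasoning)
open import Relation.Nullary using (contradiction)

-- k₁/n ≥ p₁/q₁ and k₂/n ≥ p₂/q₂ with p₁/q₁ + p₂/q₂ > 1, denominators cleared.
fraction-sum>1⇒n<k₁+k₂ : ∀ n p₁ q₁ p₂ q₂ k₁ k₂ → .{{NonZero n}} →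
                         p₁ * n ≤ q₁ * k₁ → p₂ * n ≤ q₂ * k₂ →
                         q₁ * q₂ < p₁ * q₂ + p₂ * q₁ → n < k₁ + k₂
fraction-sum>1⇒n<k₁+k₂ n p₁ q₁ p₂ q₂ k₁ k₂ p₁n≤q₁k₁ p₂n≤q₂k₂ q₁q₂<p₁q₂+p₂q₁ =
  *-cancelʳ-< (q₁ * q₂) n (k₁ + k₂) (begin-strict
    n * (q₁ * q₂)                    <⟨ *-monoʳ-< n q₁q₂<p₁q₂+p₂q₁ ⟩
    n * (p₁ * q₂ + p₂ * q₁)          ≡⟨ solve (n ∷ p₁ ∷ q₁ ∷ p₂ ∷ q₂ ∷ []) ⟩
    p₁ * n * q₂ + p₂ * n * q₁        ≤⟨ +-mono-≤ (*-monoˡ-≤ q₂ p₁n≤q₁k₁) (*-monoˡ-≤ q₁ p₂n≤q₂k₂) ⟩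
    q₁ * k₁ * q₂ + q₂ * k₂ * q₁      ≡⟨ solve (q₁ ∷ k₁ ∷ q₂ ∷ k₂ ∷ []) ⟩
    (k₁ + k₂) * (q₁ * q₂)            ∎)
  where open ≤-Reasoning

splitAt-injective : ∀ m {n} → Injective _≡_ _≡_ (splitAt m {n})
splitAt-injective m {n} {i} {j} eq =
  trans (sym (join-splitAt m n i)) (trans (cong (join m n) eq) (join-splitAt m n j))

injective-images-meet : ∀ {m m′ n} → n < m + m′ →
                        (f : Fin m → Fin n) (g : Fin m′ → Fin n) →
                        Injective _≡_ _≡_ f → Injective _≡_ _≡_ g →
                        ∃[ i ] ∃[ j ] f i ≡ g j
injective-images-meet {m} {m′} n<m+m′ f g f-injective g-injective
  with i , j , i<j , eq ← pigeonhole n<m+m′ ([ f , g ]′ ∘ splitAt m)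
  = collision (splitAt m i) (splitAt m j) (<⇒≢ i<j ∘ splitAt-injective m) eq
  where
  collision : (p q : Fin m ⊎ Fin m′) → p ≢ q → [ f , g ]′ p ≡ [ f , g ]′ q →
              ∃[ i ] ∃[ j ] f i ≡ g j
  collision (inj₁ a) (inj₁ b) a≢b eq = contradiction (cong inj₁ (f-injective eq)) a≢b
  collision (inj₁ a) (inj₂ b) _   eq = a , b , eq
  collision (inj₂ a) (inj₁ b) _   eq = b , a , sym eq
  collision (inj₂ a) (inj₂ b) a≢b eq = contradiction (cong inj₂ (g-injective eq)) a≢b

module _ {c} {X : Set c} where

  ≢[]⇒length-nonZero : ∀ {xs : List X} → xs ≢ [] → NonZero (length xs)
  ≢[]⇒length-nonZero {xs = []}    []≢[] = contradiction refl []≢[]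
  ≢[]⇒length-nonZero {xs = _ ∷ _} _     = _

  Unique-resp-⊆ : Unique {A = X} Respects _⊇_
  Unique-resp-⊆ []         []                  = []
  Unique-resp-⊆ (_ ∷ʳ τ)   (_ ∷ xs-unique)     = Unique-resp-⊆ τ xs-unique
  Unique-resp-⊆ (refl ∷ τ) (x∉xs ∷ xs-unique) = All-resp-⊆ τ x∉xs ∷ Unique-resp-⊆ τ xs-unique

  lookup-injective : ∀ {xs : List X} → Unique xs → Injective _≡_ _≡_ (lookup xs)
  lookup-injective {x ∷ xs} _               {zero}  {zero}  _  = refl
  lookup-injective {x ∷ xs} (x∉xs ∷ _)      {zero}  {suc j} eq =
    contradiction eq (All.lookup x∉xs (∈-lookup j))
  lookup-injective {x ∷ xs} (x∉xs ∷ _)      {suc i} {zero}  eq =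
    contradiction (sym eq) (All.lookup x∉xs (∈-lookup i))
  lookup-injective {x ∷ xs} (_ ∷ xs-unique) {suc i} {suc j} eq =
    cong suc (lookup-injective xs-unique eq)

  position : ∀ {S I : List X} → S Subset.⊆ I → Fin (length S) → Fin (length I)
  position S⊆I i = index (S⊆I (∈-lookup i))

  position-≡⇒lookup-≡ : ∀ {S T I : List X} (S⊆I : S Subset.⊆ I) (T⊆I : T Subset.⊆ I) {i j} →
                         position S⊆I i ≡ position T⊆I j → lookup S i ≡ lookup T j
  position-≡⇒lookup-≡ {S} {T} {I} S⊆I T⊆I {i} {j} eq = begin
    lookup S i                ≡⟨ lookup-index (S⊆I (∈-lookup i)) ⟩
    lookup I (position S⊆I i) ≡⟨ cong (lookup I) eq ⟩
    lookup I (position T⊆I j) ≡⟨ lookup-index (T⊆I (∈-lookup j)) ⟨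
    lookup T j                ∎
    where open ≡-Reasoning

  position-injective : ∀ {S I : List X} → Unique S → (S⊆I : S Subset.⊆ I) →
                       Injective _≡_ _≡_ (position S⊆I)
  position-injective S-unique S⊆I = lookup-injective S-unique ∘ position-≡⇒lookup-≡ S⊆I S⊆I

  common-element : ∀ {S T I : List X} → Unique S → Unique T → S Subset.⊆ I → T Subset.⊆ I →
                   length I < length S + length T → ∃[ u ] u ∈ S × u ∈ T
  common-element {S} {T} S-unique T-unique S⊆I T⊆I |I|<|S|+|T|
    with i , j , eq ← injective-images-meet |I|<|S|+|T| (position S⊆I) (position T⊆I)
                        (position-injective S-unique S⊆I) (position-injective T-unique T⊆I)
    = lookup S i , ∈-lookup i , subst (_∈ T) (sym (position-≡⇒lookup-≡ S⊆I T⊆I eq)) (∈-lookup j)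

module _ {c ℓ} (G : PoGroup c ℓ) where
  open PoGroup G
  open IsGroup isGroup using (_//_; inverseʳ; identityʳ)
  private
    group : Group c c
    group = record { isGroup = isGroup }

  open GroupProperties group
    using (∙-cancelˡ; ⁻¹-injective; ε⁻¹≈ε; x∙y⁻¹≈ε⇒x≈y; identityʳ-unique; //-rightDividesˡ)

  //-injectiveʳ : ∀ x → Injective _≡_ _≡_ (x //_)
  //-injectiveʳ x {v} {w} eq = ⁻¹-injective (∙-cancelˡ x (v ⁻¹) (w ⁻¹) eq)

  //-preserves-OpenInterval : ∀ {x v} → OpenInterval x v → OpenInterval x (x // v)
  //-preserves-OpenInterval {x} {v} ((e≤v , e≢v) , (v≤x , v≢x)) =
    (e≤x//v , e≢x//v) , (x//v≤x , x//v≢x)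
    where
    e≤x//v : e ≤ᴳ x // v
    e≤x//v = subst (_≤ᴳ x // v) (inverseʳ v) (mono-right (v ⁻¹) v≤x)

    e≢x//v : e ≢ x // v
    e≢x//v e≡x//v = v≢x (sym (x∙y⁻¹≈ε⇒x≈y x v (sym e≡x//v)))

    x//v≤x : x // v ≤ᴳ x
    x//v≤x = subst₂ _≤ᴳ_ (identityʳ (x // v)) (//-rightDividesˡ v x) (mono-left (x // v) e≤v)

    x//v≢x : x // v ≢ x
    x//v≢x x//v≡x = e≢v (sym (⁻¹-injective (trans (identityʳ-unique x (v ⁻¹) x//v≡x) (sym ε⁻¹≈ε))))

  //-image-⊆ : ∀ {x I T} → Enumerates G I (OpenInterval x) → T Subset.⊆ I → map (x //_) T Subset.⊆ I
  //-image-⊆ {x} (_ , I-enumerates) T⊆I y∈x//T with v , v∈T , refl ← ∈-map⁻ (x //_) y∈x//T =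
    Equivalence.from (I-enumerates (x // v))
      (//-preserves-OpenInterval (Equivalence.to (I-enumerates v) (T⊆I v∈T)))

  factorisation-in-OpenInterval : ∀ {x I S T} → Enumerates G I (OpenInterval x) →
                                  Unique S → Unique T → S Subset.⊆ I → T Subset.⊆ I →
                                  length I < length S + length T →
                                  ∃[ u ] ∃[ v ] (u ∈ S × v ∈ T × u ∙ v ≡ x)
  factorisation-in-OpenInterval {x} {I} {S} {T} I-enumerates S-unique T-unique S⊆I T⊆I |I|<|S|+|T|
    with u , u∈S , u∈x//T ← common-element S-unique (map⁺ (//-injectiveʳ x) T-unique) S⊆I
                              (//-image-⊆ I-enumerates T⊆I)
                              (subst (λ k → length I < length S + k) (sym (length-map (x //_) T)) |I|<|S|+|T|)
    with v , v∈T , refl ← ∈-map⁻ (x //_) u∈x//T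
    = x // v , v , u∈S , v∈T , //-rightDividesˡ v x

  large-subsets-factorise : ∀ {a b} {A : Carrier → Set a} {B : Carrier → Set b} {x I kA kB} →
                            Enumerates G I (OpenInterval x) →
                            AtLeastIn G A I kA → AtLeastIn G B I kB → length I < kA + kB →
                            ∃[ u ] ∃[ v ] (A u × B v × u ∙ v ≡ x)
  large-subsets-factorise I-enumerates@(I-unique , _)
                          (SA , SA⊆I , SA⊆A , refl) (SB , SB⊆I , SB⊆B , refl) |I|<|SA|+|SB|
    with u , v , u∈SA , v∈SB , uv≡x ←
           factorisation-in-OpenInterval I-enumerates
             (Unique-resp-⊆ SA⊆I I-unique) (Unique-resp-⊆ SB⊆I I-unique)
             (Sublist.lookup SA⊆I) (Sublist.lookup SB⊆I) |I|<|SA|+|SB|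
    = u , v , All.lookup SA⊆A u∈SA , All.lookup SB⊆B v∈SB , uv≡x

theorem2p2 : ∀ {c ℓ j a b : Level} (G : PoGroup c ℓ) →
  let open PoGroup G in
  (𝒥 : List Carrier → Set j) →
  (∀ J → 𝒥 J → NonemptyFinitePosSubset G J) →
  (A : Carrier → Set a) → (B : Carrier → Set b) →
  (∀ y → A y → Pos y) → (∀ y → B y → Pos y) →
  (pA qA pB qB : ℕ) → .{{NonZero qA}} → .{{NonZero qB}} →
  DensityLowerBound G 𝒥 A pA qA → DensityLowerBound G 𝒥 B pB qB →
  qA * qB < pA * qB + pB * qA →
  (x : Carrier) → Pos x →
  (I : List Carrier) → 𝒥 I → Enumerates G I (OpenInterval x) →
  ∃[ u ] ∃[ v ] (A u × B v × (u ∙ v ≡ x))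
theorem2p2 G _ 𝒥-nonempty _ _ _ _ pA qA pB qB A-dense B-dense density-sum>1 _ _ I I∈𝒥 I-enumerates =
  let kA , A∩I≥kA , pA|I|≤qAkA = A-dense I I∈𝒥
      kB , B∩I≥kB , pB|I|≤qBkB = B-dense I I∈𝒥
      _ , I≢[] , _ = 𝒥-nonempty I I∈𝒥
  in large-subsets-factorise G I-enumerates A∩I≥kA B∩I≥kB
       (fraction-sum>1⇒n<k₁+k₂ (length I) pA qA pB qB kA kB {{≢[]⇒length-nonZero I≢[]}}
          pA|I|≤qAkA pB|I|≤qBkB density-sum>1)
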